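{- For all positive integers $n,k,u$ with $k,u\le n$, $$\sum_{i=1}^{u}(-1)^{i-1}(i-1)!\,S(u,i)\binom{n-i}{k-i}=\sum_{j=1}^{k}(-1)^{j-1}j^{u-1}\binom{n}{k-j}.$$
   Context: $S(u,i)$ is the Stirling number of the second kind (number of partitions of a $u$-element set into $i$ nonempty blocks). Binomial coefficients $\binom{a}{b}$ are $0$ unless $0\le b\le a$. -}

module Defs where

open import Data.Nat using (ℕ; zero; suc; _+_; _*_; _∸_; _≤ᵇ_)
open import Data.Bool using (if_then_else_)
open import Data.Nat.Combinatorics using (_C_)
open import Data.Integer using (ℤ; +_)
import Data.Integer as ℤ

S : ℕ → ℕ → ℕ
S zero    zero    = 1
S zero    (suc i) = 0
S (suc u) zero    = 0
S (suc u) (suc i) = suc i * S u (suc i) + S u i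

-- binomDiff a c b d = binom(a - c, b - d) with integer (untruncated)
-- differences: it is 0 when a < c or b < d (negative arguments) and
-- otherwise the stdlib _C_, which is 0 when b - d > a - c.
binomDiff : ℕ → ℕ → ℕ → ℕ → ℕ
binomDiff a c b d =
  if c ≤ᵇ a then (if d ≤ᵇ b then (a ∸ c) C (b ∸ d) else 0) else 0

sign : ℕ → ℤ
sign zero    = + 1
sign (suc m) = ℤ.- sign m

sum1 : ℕ → (ℕ → ℤ) → ℤ
sum1 zero    f = + 0
sum1 (suc m) f = sum1 m f ℤ.+ f (suc m)

{-# OPTIONS --safe #-}
-- Write L(n,k,u) and R(n,k,u) for the two sides. Both satisfy
--   F(n+1,k+1,u+1) = (k+1) F(n+1,k+1,u) - (n+1) F(n,k,u).
-- For R this holds termwise by the absorption identity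
-- j C(n+1,k+1-j) + (n+1) C(n,k-j) = (k+1) C(n+1,k+1-j). For L, the Stirling recurrence
-- makes the weight (-1)^i i! S(u+1,i+1) a difference w(i) - w(i+1) of the numbers
-- w(i) = (-1)^i i! S(u,i); absorption then splits L(n+1,k+1,u+1) into the right-hand
-- side of the recurrence plus a telescoping sum, which vanishes because w(0) = w(u+1) = 0.
-- Both sides vanish for k = 0 and equal C(n-1,k-1) for u = 1 (for R by an alternating
-- telescoping of Pascal's rule), so induction on u proves the identity whenever k <= n.
module Submission where

open import Data.Bool using (true; false)
open import Data.Nat using (ℕ; zero; suc; _≤_; _<_; _>_; _≤ᵇ_; _∸_; _^_; _!; s≤s; z<s; s<s)
import Data.Nat as ℕ
import Data.Nat.Properties as ℕ
open import Data.Nat.Combinatorics using (_C_; nC1≡n; nCk+nC[k+1]≡[n+1]C[k+1])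
open import Relation.Binary.PropositionalEquality
  using (_≡_; refl; sym; trans; cong; cong₂; module ≡-Reasoning)
open import Relation.Nullary using (contradiction)

open import Defs

module _ where
  open import Data.Nat using (_+_; _*_)
  open import Data.Nat.Tactic.RingSolver using (solve-∀)
  open ≡-Reasoning

  [n+1]*nCk≡[k+1]*[n+1]C[k+1] : ∀ n k → suc n * (n C k) ≡ suc k * (suc n C suc k)
  [n+1]*nCk≡[k+1]*[n+1]C[k+1] zero    zero    = refl
  [n+1]*nCk≡[k+1]*[n+1]C[k+1] zero    (suc k) = sym (ℕ.*-zeroʳ (suc (suc k)))
  [n+1]*nCk≡[k+1]*[n+1]C[k+1] (suc n) zero    =
    trans (ℕ.*-identityʳ (suc (suc n))) (sym (trans (ℕ.+-identityʳ _) (nC1≡n (suc (suc n)))))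
  [n+1]*nCk≡[k+1]*[n+1]C[k+1] (suc n) (suc k) = begin
      suc (suc n) * (suc n C suc k)          ≡⟨ cong (suc (suc n) *_) (sym (pascal n k)) ⟩
      suc (suc n) * (a + b)                  ≡⟨ expand (suc n) a b ⟩
      (a + b) + (suc n * a + suc n * b)      ≡⟨ cong₂ (λ x y → (a + b) + (x + y))
                                                  ([n+1]*nCk≡[k+1]*[n+1]C[k+1] n k)
                                                  ([n+1]*nCk≡[k+1]*[n+1]C[k+1] n (suc k)) ⟩
      (a + b) + (suc k * c + suc (suc k) * d) ≡⟨ cong (_+ (suc k * c + suc (suc k) * d)) (pascal n k) ⟩
      c + (suc k * c + suc (suc k) * d)      ≡⟨ collect (suc k) c d ⟩
      suc (suc k) * (c + d)                  ≡⟨ cong (suc (suc k) *_) (pascal (suc n) (suc k)) ⟩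
      suc (suc k) * (suc (suc n) C suc (suc k)) ∎
    where
    pascal = nCk+nC[k+1]≡[n+1]C[k+1]
    a = n C k
    b = n C suc k
    c = suc n C suc k
    d = suc n C suc (suc k)
    expand : ∀ m x y → suc m * (x + y) ≡ (x + y) + (m * x + m * y)
    expand = solve-∀
    collect : ∀ m x y → x + (m * x + suc m * y) ≡ suc m * (x + y)
    collect = solve-∀

  binomDiff-sucˡ : ∀ a c b d → binomDiff (suc a) (suc c) b d ≡ binomDiff a c b d
  binomDiff-sucˡ a zero    b d = refl
  binomDiff-sucˡ a (suc c) b d = refl

  binomDiff-sucʳ : ∀ a c b d → binomDiff a c (suc b) (suc d) ≡ binomDiff a c b d
  binomDiff-sucʳ a c b zero    = refl
  binomDiff-sucʳ a c b (suc d) = refl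

  binomDiff-suc : ∀ a c b d → binomDiff (suc a) (suc c) (suc b) (suc d) ≡ binomDiff a c b d
  binomDiff-suc a c b d = trans (binomDiff-sucˡ a c (suc b) (suc d)) (binomDiff-sucʳ a c b d)

  binomDiff-≡0 : ∀ a c b d → b < d → binomDiff a c b d ≡ 0
  binomDiff-≡0 a c b d b<d with c ≤ᵇ a | d ≤ᵇ b | ℕ.≤ᵇ⇒≤ d b
  ... | false | _     | _   = refl
  ... | true  | false | _   = refl
  ... | true  | true  | d≤b = contradiction (d≤b _) (ℕ.<⇒≱ b<d)

  binomDiff-pascal : ∀ n k j → binomDiff (suc n) 0 k j ≡ binomDiff n 0 k j + binomDiff n 0 k (suc j)
  binomDiff-pascal n zero    zero    = refl
  binomDiff-pascal n (suc k) zero    =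
    trans (sym (nCk+nC[k+1]≡[n+1]C[k+1] n k)) (ℕ.+-comm (n C k) (n C suc k))
  binomDiff-pascal n zero    (suc j) = refl
  binomDiff-pascal n (suc k) (suc j)
    rewrite binomDiff-sucʳ (suc n) 0 k j | binomDiff-sucʳ n 0 k j | binomDiff-sucʳ n 0 k (suc j)
    = binomDiff-pascal n k j

  private
    suc-coefficients : ∀ a b c d x y → a * y + b * x ≡ c * x + d * y →
                       suc a * y + suc b * x ≡ suc c * x + suc d * y
    suc-coefficients a b c d x y eq = begin
      suc a * y + suc b * x       ≡⟨ regroup a b x y ⟩
      (a * y + b * x) + (x + y)   ≡⟨ cong (_+ (x + y)) eq ⟩
      (c * x + d * y) + (x + y)   ≡⟨ regroup′ c d x y ⟩
      suc c * x + suc d * y       ∎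
      where
      regroup : ∀ a b x y → suc a * y + suc b * x ≡ (a * y + b * x) + (x + y)
      regroup = solve-∀
      regroup′ : ∀ c d x y → (c * x + d * y) + (x + y) ≡ suc c * x + suc d * y
      regroup′ = solve-∀

    vanishing-terms : ∀ a b c d {x y} → x ≡ 0 → y ≡ 0 → a * y + b * x ≡ c * x + d * y
    vanishing-terms a b c d refl refl = zeros a b c d
      where
      zeros : ∀ a b c d → a * 0 + b * 0 ≡ c * 0 + d * 0
      zeros = solve-∀

  -- (n - i) C(n-i-1, k-i-1) = (k - i) C(n-i, k-i), with i + 1 added to both coefficients
  -- so that no subtraction occurs.
  binomDiff-absorption : ∀ n k i →
    suc n * binomDiff n (suc i) k (suc i) + suc i * binomDiff n i k i ≡
    suc k * binomDiff n i k i + suc i * binomDiff n (suc i) k (suc i)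
  binomDiff-absorption n k zero =
    suc-coefficients n 0 k 0 (n C k) (binomDiff n 1 k 1) (cong (_+ 0) (unshifted n k))
    where
    unshifted : ∀ n k → n * binomDiff n 1 k 1 ≡ k * (n C k)
    unshifted zero    zero    = refl
    unshifted zero    (suc k) = sym (ℕ.*-zeroʳ (suc k))
    unshifted (suc n) zero    = ℕ.*-zeroʳ (suc n)
    unshifted (suc n) (suc k) = [n+1]*nCk≡[k+1]*[n+1]C[k+1] n k
  binomDiff-absorption zero k (suc i) = vanishing-terms 1 (suc (suc i)) (suc k) (suc (suc i)) refl refl
  binomDiff-absorption (suc n) zero (suc i) =
    vanishing-terms (suc (suc n)) (suc (suc i)) 1 (suc (suc i))
      (binomDiff-≡0 (suc n) (suc i) 0 (suc i) z<s) (binomDiff-≡0 (suc n) (suc (suc i)) 0 (suc (suc i)) z<s)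
  binomDiff-absorption (suc n) (suc k) (suc i)
    rewrite binomDiff-suc n (suc i) k (suc i) | binomDiff-suc n i k i
    = suc-coefficients (suc n) (suc i) (suc k) (suc i)
        (binomDiff n i k i) (binomDiff n (suc i) k (suc i)) (binomDiff-absorption n k i)

  -- (k + 1 - j) C(n + 1, k + 1 - j) = (n + 1) C(n, k - j), with the j-term moved to the left.
  binomDiff₀-absorption : ∀ n k j →
    j * binomDiff (suc n) 0 (suc k) j + suc n * binomDiff n 0 k j ≡ suc k * binomDiff (suc n) 0 (suc k) j
  binomDiff₀-absorption n k       zero          = [n+1]*nCk≡[k+1]*[n+1]C[k+1] n k
  binomDiff₀-absorption n zero    (suc zero)    = cong suc (ℕ.*-zeroʳ (suc n))
  binomDiff₀-absorption n zero    (suc (suc j)) = cong₂ _+_ (ℕ.*-zeroʳ (suc (suc j))) (ℕ.*-zeroʳ (suc n))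
  binomDiff₀-absorption n (suc k) (suc j)
    rewrite binomDiff-sucʳ (suc n) 0 (suc k) j | binomDiff-sucʳ n 0 k j = begin
      suc j * y + suc n * z    ≡⟨ ℕ.+-assoc y (j * y) (suc n * z) ⟩
      y + (j * y + suc n * z)  ≡⟨ cong (y +_) (binomDiff₀-absorption n k j) ⟩
      y + suc k * y            ∎
    where
    y = binomDiff (suc n) 0 (suc k) j
    z = binomDiff n 0 k j

  i>u⇒Sui≡0 : ∀ {u i} → i > u → S u i ≡ 0
  i>u⇒Sui≡0 {zero}  {suc i} _ = refl
  i>u⇒Sui≡0 {suc u} {suc i} (s<s u<i)
    rewrite i>u⇒Sui≡0 (ℕ.m<n⇒m<1+n u<i) | i>u⇒Sui≡0 u<i = cong (_+ 0) (ℕ.*-zeroʳ (suc i))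

open import Data.Integer using (ℤ; +_; -_; _+_; _-_; _*_)
import Data.Integer.Properties as ℤ
open import Data.Integer.Tactic.RingSolver using (solve-∀)
open ≡-Reasoning

sum1-cong : ∀ m {f g : ℕ → ℤ} → (∀ i → f (suc i) ≡ g (suc i)) → sum1 m f ≡ sum1 m g
sum1-cong zero    eq = refl
sum1-cong (suc m) eq = cong₂ _+_ (sum1-cong m eq) (eq m)

sum1-≡0 : ∀ m {f : ℕ → ℤ} → (∀ i → f (suc i) ≡ + 0) → sum1 m f ≡ + 0
sum1-≡0 zero    eq = refl
sum1-≡0 (suc m) eq = cong₂ _+_ (sum1-≡0 m eq) (eq m)

sum1-last-≡0 : ∀ m {f : ℕ → ℤ} → f (suc m) ≡ + 0 → sum1 (suc m) f ≡ sum1 m f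
sum1-last-≡0 m {f} eq = trans (cong (λ x → sum1 m f + x) eq) (ℤ.+-identityʳ (sum1 m f))

sum1-+ : ∀ m (f g : ℕ → ℤ) → sum1 m (λ i → f i + g i) ≡ sum1 m f + sum1 m g
sum1-+ zero    f g = refl
sum1-+ (suc m) f g =
  trans (cong (_+ (f (suc m) + g (suc m))) (sum1-+ m f g)) (interchange (sum1 m f) (sum1 m g) _ _)
  where
  interchange : ∀ a b c d → (a + b) + (c + d) ≡ (a + c) + (b + d)
  interchange = solve-∀

sum1-linear : ∀ m a b (f g : ℕ → ℤ) → sum1 m (λ i → a * f i - b * g i) ≡ a * sum1 m f - b * sum1 m g
sum1-linear zero    a b f g = sym (cong₂ _-_ (ℤ.*-zeroʳ a) (ℤ.*-zeroʳ b))
sum1-linear (suc m) a b f g =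
  trans (cong (_+ (a * f (suc m) - b * g (suc m))) (sum1-linear m a b f g))
        (distrib a b (sum1 m f) (sum1 m g) _ _)
  where
  distrib : ∀ a b F G x y → (a * F - b * G) + (a * x - b * y) ≡ a * (F + x) - b * (G + y)
  distrib = solve-∀

sum1-telescope : ∀ m (d : ℕ → ℤ) → sum1 m (λ i → d (i ∸ 1) - d i) ≡ d 0 - d m
sum1-telescope zero    d = sym (ℤ.+-inverseʳ (d 0))
sum1-telescope (suc m) d = trans (cong (_+ (d m - d (suc m))) (sum1-telescope m d)) (cancel (d 0) (d m) _)
  where
  cancel : ∀ a b c → (a - b) + (b - c) ≡ a - c
  cancel = solve-∀

*-vanishesʳ : ∀ a {b} → b ≡ 0 → a * + b ≡ + 0
*-vanishesʳ a refl = ℤ.*-zeroʳ a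

stirlingWeight : ℕ → ℕ → ℤ
stirlingWeight u i = sign (i ∸ 1) * + ((i ∸ 1) !) * + S u i

signedStirling : ℕ → ℕ → ℤ
signedStirling u i = sign i * + (i !) * + S u i

stirlingWeight-suc : ∀ u i → stirlingWeight (suc u) (suc i) ≡ signedStirling u i - signedStirling u (suc i)
stirlingWeight-suc u i = begin
    sign i * + (i !) * + S (suc u) (suc i)
  ≡⟨ cong (sign i * + (i !) *_)
          (trans (ℤ.pos-+ _ (S u i)) (cong (_+ + S u i) (ℤ.pos-* (suc i) (S u (suc i))))) ⟩
    sign i * + (i !) * (+ suc i * + S u (suc i) + + S u i)
  ≡⟨ rearrange (sign i) (+ (i !)) (+ suc i) (+ S u (suc i)) (+ S u i) ⟩
    sign i * + (i !) * + S u i - (- sign i) * (+ suc i * + (i !)) * + S u (suc i)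
  ≡⟨ cong (λ f → signedStirling u i - (- sign i) * f * + S u (suc i)) (sym (ℤ.pos-* (suc i) (i !))) ⟩
    signedStirling u i - signedStirling u (suc i)
  ∎
  where
  rearrange : ∀ σ f s a b → σ * f * (s * a + b) ≡ σ * f * b - (- σ) * (s * f) * a
  rearrange = solve-∀

signedStirling-suc : ∀ u i → signedStirling u (suc i) ≡ - (+ suc i * stirlingWeight u (suc i))
signedStirling-suc u i = begin
    (- sign i) * + (suc i ! ) * + S u (suc i)
  ≡⟨ cong (λ f → (- sign i) * f * + S u (suc i)) (ℤ.pos-* (suc i) (i !)) ⟩
    (- sign i) * (+ suc i * + (i !)) * + S u (suc i)
  ≡⟨ rearrange (sign i) (+ suc i) (+ (i !)) (+ S u (suc i)) ⟩
    - (+ suc i * (sign i * + (i !) * + S u (suc i)))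
  ∎
  where
  rearrange : ∀ σ s f a → (- σ) * (s * f) * a ≡ - (s * (σ * f * a))
  rearrange = solve-∀

stirlingWeight-≡0 : ∀ {u i} → i > u → stirlingWeight u i ≡ + 0
stirlingWeight-≡0 {i = i} i>u = *-vanishesʳ (sign (i ∸ 1) * + ((i ∸ 1) !)) (i>u⇒Sui≡0 i>u)

signedStirling-≡0 : ∀ {u i} → i > u → signedStirling u i ≡ + 0
signedStirling-≡0 {i = i} i>u = *-vanishesʳ (sign i * + (i !)) (i>u⇒Sui≡0 i>u)

pos-linear : ∀ a b c d → + (a ℕ.* b ℕ.+ c ℕ.* d) ≡ + a * + b + + c * + d
pos-linear a b c d = trans (ℤ.pos-+ (a ℕ.* b) (c ℕ.* d)) (cong₂ _+_ (ℤ.pos-* a b) (ℤ.pos-* c d))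

lhs : ℕ → ℕ → ℕ → ℤ
lhs n k u = sum1 u (λ i → stirlingWeight u i * + binomDiff n i k i)

rhs : ℕ → ℕ → ℕ → ℤ
rhs n k u = sum1 k (λ j → sign (j ∸ 1) * + (j ^ (u ∸ 1)) * + binomDiff n 0 k j)

lhs-term : ∀ u n k i →
  stirlingWeight (suc u) (suc i) * + binomDiff (suc n) (suc i) (suc k) (suc i) ≡
  (+ suc k * (stirlingWeight u (suc i) * + binomDiff (suc n) (suc i) (suc k) (suc i))
   - + suc n * (stirlingWeight u (suc i) * + binomDiff n (suc i) k (suc i)))
  + (signedStirling u i * + binomDiff n i k i - signedStirling u (suc i) * + binomDiff n (suc i) k (suc i))
lhs-term u n k i
  rewrite binomDiff-suc n i k i | stirlingWeight-suc u i | signedStirling-suc u i = begin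
    (w - - (s * t)) * x
  ≡⟨ expand w t x y s K N ⟩
    rest + t * ((N * y + s * x) - (K * x + s * y))
  ≡⟨ cong (λ e → rest + t * (e - (K * x + s * y))) absorption ⟩
    rest + t * ((K * x + s * y) - (K * x + s * y))
  ≡⟨ cancel rest t (K * x + s * y) ⟩
    rest
  ∎
  where
  w = signedStirling u i
  t = stirlingWeight u (suc i)
  X = binomDiff n i k i
  Y = binomDiff n (suc i) k (suc i)
  x = + X
  y = + Y
  s = + suc i
  K = + suc k
  N = + suc n
  rest = (K * (t * x) - N * (t * y)) + (w * x - - (s * t) * y)
  absorption : N * y + s * x ≡ K * x + s * y
  absorption = trans (sym (pos-linear (suc n) Y (suc i) X))
                     (trans (cong +_ (binomDiff-absorption n k i)) (pos-linear (suc k) X (suc i) Y))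
  expand : ∀ w t x y s K N →
    (w - - (s * t)) * x ≡
    ((K * (t * x) - N * (t * y)) + (w * x - - (s * t) * y)) + t * ((N * y + s * x) - (K * x + s * y))
  expand = solve-∀
  cancel : ∀ r t e → r + t * (e - e) ≡ r
  cancel = solve-∀

lhs-recurrence : ∀ u n k →
  lhs (suc n) (suc k) (suc (suc u)) ≡ + suc k * lhs (suc n) (suc k) (suc u) - + suc n * lhs n k (suc u)
lhs-recurrence u n k = begin
    lhs (suc n) (suc k) (suc (suc u))
  ≡⟨ sum1-cong (suc (suc u)) (lhs-term (suc u) n k) ⟩
    sum1 (suc (suc u)) (λ i → (K * a i - N * b i) + (d (i ∸ 1) - d i))
  ≡⟨ sum1-+ (suc (suc u)) (λ i → K * a i - N * b i) (λ i → d (i ∸ 1) - d i) ⟩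
    sum1 (suc (suc u)) (λ i → K * a i - N * b i) + sum1 (suc (suc u)) (λ i → d (i ∸ 1) - d i)
  ≡⟨ cong₂ _+_ (sum1-linear (suc (suc u)) K N a b) (sum1-telescope (suc (suc u)) d) ⟩
    (K * sum1 (suc (suc u)) a - N * sum1 (suc (suc u)) b) + (d 0 - d (suc (suc u)))
  ≡⟨ cong₂ (λ p q → (K * p - N * q) + (d 0 - d (suc (suc u))))
           (sum1-last-≡0 (suc u) (weight-top-≡0 _)) (sum1-last-≡0 (suc u) (weight-top-≡0 _)) ⟩
    (K * lhs (suc n) (suc k) (suc u) - N * lhs n k (suc u)) + (d 0 - d (suc (suc u)))
  ≡⟨ cong (λ e → (K * lhs (suc n) (suc k) (suc u) - N * lhs n k (suc u)) + (d 0 - e)) (signed-top-≡0 _) ⟩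
    -- d 0 is + 0 by computation, since S (suc u) 0 = 0
    (K * lhs (suc n) (suc k) (suc u) - N * lhs n k (suc u)) + + 0
  ≡⟨ ℤ.+-identityʳ _ ⟩
    K * lhs (suc n) (suc k) (suc u) - N * lhs n k (suc u)
  ∎
  where
  K = + suc k
  N = + suc n
  a b d : ℕ → ℤ
  a i = stirlingWeight (suc u) i * + binomDiff (suc n) i (suc k) i
  b i = stirlingWeight (suc u) i * + binomDiff n i k i
  d i = signedStirling (suc u) i * + binomDiff n i k i
  weight-top-≡0 : ∀ x → stirlingWeight (suc u) (suc (suc u)) * x ≡ + 0
  weight-top-≡0 x = cong (_* x) (stirlingWeight-≡0 (ℕ.n<1+n (suc u)))
  signed-top-≡0 : ∀ x → signedStirling (suc u) (suc (suc u)) * x ≡ + 0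
  signed-top-≡0 x = cong (_* x) (signedStirling-≡0 (ℕ.n<1+n (suc u)))

rhs-term : ∀ u n k j →
  sign j * + (suc j ^ suc u) * + binomDiff (suc n) 0 (suc k) (suc j) ≡
  + suc k * (sign j * + (suc j ^ u) * + binomDiff (suc n) 0 (suc k) (suc j))
  - + suc n * (sign j * + (suc j ^ u) * + binomDiff n 0 k (suc j))
rhs-term u n k j = begin
    σ * + (suc j ^ suc u) * z
  ≡⟨ cong (λ e → σ * e * z) (ℤ.pos-* (suc j) (suc j ^ u)) ⟩
    σ * (s * p) * z
  ≡⟨ expand σ p z w s N ⟩
    σ * p * (s * z + N * w) - N * (σ * p * w)
  ≡⟨ cong (λ e → σ * p * e - N * (σ * p * w)) absorption ⟩
    σ * p * (K * z) - N * (σ * p * w)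
  ≡⟨ reorder σ p z w K N ⟩
    K * (σ * p * z) - N * (σ * p * w)
  ∎
  where
  Z = binomDiff (suc n) 0 (suc k) (suc j)
  W = binomDiff n 0 k (suc j)
  σ = sign j
  p = + (suc j ^ u)
  z = + Z
  w = + W
  s = + suc j
  K = + suc k
  N = + suc n
  absorption : s * z + N * w ≡ K * z
  absorption = trans (sym (pos-linear (suc j) Z (suc n) W))
                     (trans (cong +_ (binomDiff₀-absorption n k (suc j))) (ℤ.pos-* (suc k) Z))
  expand : ∀ σ p z w s N → σ * (s * p) * z ≡ σ * p * (s * z + N * w) - N * (σ * p * w)
  expand = solve-∀
  reorder : ∀ σ p z w K N → σ * p * (K * z) - N * (σ * p * w) ≡ K * (σ * p * z) - N * (σ * p * w)
  reorder = solve-∀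

rhs-recurrence : ∀ u n k →
  rhs (suc n) (suc k) (suc (suc u)) ≡ + suc k * rhs (suc n) (suc k) (suc u) - + suc n * rhs n k (suc u)
rhs-recurrence u n k = begin
    rhs (suc n) (suc k) (suc (suc u))
  ≡⟨ sum1-cong (suc k) (rhs-term u n k) ⟩
    sum1 (suc k) (λ j → K * p j - N * q j)
  ≡⟨ sum1-linear (suc k) K N p q ⟩
    K * rhs (suc n) (suc k) (suc u) - N * sum1 (suc k) q
  ≡⟨ cong (λ e → K * rhs (suc n) (suc k) (suc u) - N * e) (sum1-last-≡0 k q-top-≡0) ⟩
    K * rhs (suc n) (suc k) (suc u) - N * rhs n k (suc u)
  ∎
  where
  K = + suc k
  N = + suc n
  p q : ℕ → ℤ
  p j = sign (j ∸ 1) * + (j ^ u) * + binomDiff (suc n) 0 (suc k) j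
  q j = sign (j ∸ 1) * + (j ^ u) * + binomDiff n 0 k j
  q-top-≡0 : q (suc k) ≡ + 0
  q-top-≡0 = *-vanishesʳ (sign k * + (suc k ^ u)) (binomDiff-≡0 n 0 k (suc k) (ℕ.n<1+n k))

lhs-base : ∀ n k → lhs n k 1 ≡ + binomDiff n 1 k 1
lhs-base n k = trans (ℤ.+-identityˡ (+ 1 * + binomDiff n 1 k 1)) (ℤ.*-identityˡ (+ binomDiff n 1 k 1))

rhs-base : ∀ n k → rhs (suc n) (suc k) 1 ≡ + (n C k)
rhs-base n k = begin
    rhs (suc n) (suc k) 1
  ≡⟨ sum1-cong (suc k) alternating-pascal ⟩
    sum1 (suc k) (λ j → d (j ∸ 1) - d j)
  ≡⟨ sum1-telescope (suc k) d ⟩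
    d 0 - d (suc k)
  ≡⟨ cong₂ _-_ (ℤ.*-identityˡ (+ (n C k))) d-top-≡0 ⟩
    + (n C k) - + 0
  ≡⟨ ℤ.+-identityʳ (+ (n C k)) ⟩
    + (n C k)
  ∎
  where
  d : ℕ → ℤ
  d j = sign j * + binomDiff n 0 k j
  d-top-≡0 : d (suc k) ≡ + 0
  d-top-≡0 = *-vanishesʳ (sign (suc k)) (binomDiff-≡0 n 0 k (suc k) (ℕ.n<1+n k))
  alternating-pascal : ∀ j → sign j * + 1 * + binomDiff (suc n) 0 (suc k) (suc j) ≡ d j - d (suc j)
  alternating-pascal j = begin
      sign j * + 1 * + binomDiff (suc n) 0 (suc k) (suc j)
    ≡⟨ cong (λ b → sign j * + 1 * + b) (trans (binomDiff-sucʳ (suc n) 0 k j) (binomDiff-pascal n k j)) ⟩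
      sign j * + 1 * + (binomDiff n 0 k j ℕ.+ binomDiff n 0 k (suc j))
    ≡⟨ cong (sign j * + 1 *_) (ℤ.pos-+ (binomDiff n 0 k j) (binomDiff n 0 k (suc j))) ⟩
      sign j * + 1 * (+ binomDiff n 0 k j + + binomDiff n 0 k (suc j))
    ≡⟨ alternate (sign j) (+ binomDiff n 0 k j) (+ binomDiff n 0 k (suc j)) ⟩
      d j - d (suc j)
    ∎
    where
    alternate : ∀ σ x y → σ * + 1 * (x + y) ≡ σ * x - (- σ) * y
    alternate = solve-∀

lhs≡rhs : ∀ u n k → k ≤ n → lhs n k (suc u) ≡ rhs n k (suc u)
lhs≡rhs u       n       zero    _         = sum1-≡0 (suc u) vanishes
  where
  vanishes : ∀ i → stirlingWeight (suc u) (suc i) * + binomDiff n (suc i) 0 (suc i) ≡ + 0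
  vanishes i = *-vanishesʳ (stirlingWeight (suc u) (suc i)) (binomDiff-≡0 n (suc i) 0 (suc i) z<s)
lhs≡rhs zero    (suc n) (suc k) _         = trans (lhs-base (suc n) (suc k)) (sym (rhs-base n k))
lhs≡rhs (suc u) (suc n) (suc k) (s≤s k≤n) = begin
    lhs (suc n) (suc k) (suc (suc u))
  ≡⟨ lhs-recurrence u n k ⟩
    + suc k * lhs (suc n) (suc k) (suc u) - + suc n * lhs n k (suc u)
  ≡⟨ cong₂ (λ p q → + suc k * p - + suc n * q) (lhs≡rhs u (suc n) (suc k) (s≤s k≤n)) (lhs≡rhs u n k k≤n) ⟩
    + suc k * rhs (suc n) (suc k) (suc u) - + suc n * rhs n k (suc u)
  ≡⟨ rhs-recurrence u n k ⟨
    rhs (suc n) (suc k) (suc (suc u))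
  ∎

mainTheorem5 : (n k u : ℕ) → 1 ≤ n → 1 ≤ k → 1 ≤ u → k ≤ n → u ≤ n →
    sum1 u (λ i → sign (i ∸ 1) * (+ ((i ∸ 1) !)) * (+ S u i) * (+ binomDiff n i k i))
    ≡ sum1 k (λ j → sign (j ∸ 1) * (+ (j ^ (u ∸ 1))) * (+ binomDiff n 0 k j))
mainTheorem5 n k (suc u) _ _ _ k≤n _ = lhs≡rhs u n k k≤n
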